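{- Let $(S,\gamma,(L_x)_{x\in S},(\varphi_x^y)_{x\le_\gamma y})$ be a modular connected system with sum $L$. For $x,y\in S$, $\Lambda_x\cap\Lambda_y\ne\emptyset$ if and only if $x\,\gamma\,y$.
   Context: A lattice is l.f.f.c. if every closed interval is finite and every element has finitely many upper and lower covers. $x\lessdot y$ means $y$ covers $x$. A tolerance on a lattice $S$ is a reflexive, symmetric relation $\gamma$ with $a\,\gamma\,b$, $c\,\gamma\,d$ implying $(a\vee c)\,\gamma\,(b\vee d)$ and $(a\wedge c)\,\gamma\,(b\wedge d)$; $x\le_\gamma y$ means $x\le y$ and $x\,\gamma\,y$. A modular connected system $(S,\gamma,(L_x)_{x\in S},(\varphi_x^y)_{x\le_\gamma y})$ is a lattice $S$, a tolerance $\gamma$ on $S$, lattices $L_x$ and maps $\varphi_x^y$ satisfying: (MC1) $S$ is l.f.f.c.; (MC2) each $L_x$ is finite, modular, complemented; (MC3) each $\varphi_x^y$ is a lattice isomorphism from a nonempty lattice filter $F_x^y$ of $L_x$ onto a lattice ideal $I_x^y$ of $L_y$; (MC4) $F_x^x=I_x^x=L_x$, $\varphi_x^x=\mathrm{id}$; (MC5) if $x\le_\gamma y\le_\gamma z$ and $I_x^y\cap F_y^z\neq\emptyset$ then $x\,\gamma\,z$; (MC6) for $x\le z\le y$ with $x\,\gamma\,y$: $F_x^y=(\varphi_x^z)^{ -1}(I_x^z\cap F_z^y)$, $I_x^y=\varphi_z^y(I_x^z\cap F_z^y)$, $\varphi_x^y=\varphi_z^y\circ\varphi_x^z|_{F_x^y}$;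 (MC7) if $x\,\gamma\,y$ then $I_x^{x\vee y}\cap I_y^{x\vee y}\subseteq I_{x\wedge y}^{x\vee y}$ and $F_{x\wedge y}^x\cap F_{x\wedge y}^y\subseteq F_{x\wedge y}^{x\vee y}$; (MC8.1) $x\lessdot y$ implies $x\,\gamma\,y$; (MC8.2) $x\lessdot y$ implies $F_x^y\neq L_x$ and $I_x^y\neq L_y$. Sum: $M=\{(x,a):x\in S,a\in L_x\}$, $(x,a)\sim(y,b)$ iff $x\,\gamma\,y$, $a\in F_x^{x\vee y}$, $b\in F_y^{x\vee y}$, $\varphi_x^{x\vee y}(a)=\varphi_y^{x\vee y}(b)$ (an equivalence relation); $L=M/{\sim}$; $\pi_x(a)$ is the class of $(x,a)$ and $\Lambda_x=\pi_x(L_x)\subseteq L$. -}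

module Defs where

open import Data.Product using (Σ; ∃; ∃-syntax; _×_; _,_)
open import Data.Sum using (_⊎_)
open import Data.List using (List)
open import Data.List.Membership.Propositional using (_∈_)
open import Relation.Nullary using (¬_)
open import Relation.Binary.PropositionalEquality using (_≡_)
open import Relation.Binary.Lattice.Structures using (IsLattice)
open import Function.Bundles using (_⇔_)

record LatticeOn : Set₁ where
  infixr 6 _∨_
  infixr 7 _∧_
  infix 4 _≤_
  field
    Carrier   : Set
    _≤_       : Carrier → Carrier → Set
    _∨_       : Carrier → Carrier → Carrier
    _∧_       : Carrier → Carrier → Carrier
    isLattice : IsLattice _≡_ _≤_ _∨_ _∧_

∣_∣ : LatticeOn → Set
∣ L ∣ = LatticeOn.Carrier L

module _ (L : LatticeOn) where
  open LatticeOn L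

  _⋖_ : Carrier → Carrier → Set
  x ⋖ y = (x ≤ y) × ¬ (x ≡ y) × (∀ z → x ≤ z → z ≤ y → (z ≡ x) ⊎ (z ≡ y))

  FiniteSubset : (Carrier → Set) → Set
  FiniteSubset P = Σ (List Carrier) λ xs → ∀ z → P z → z ∈ xs

  IsLFFC : Set
  IsLFFC = (∀ a b → FiniteSubset (λ c → (a ≤ c) × (c ≤ b)))
         × (∀ x → FiniteSubset (λ y → x ⋖ y))
         × (∀ x → FiniteSubset (λ y → y ⋖ x))

  IsFinite : Set
  IsFinite = Σ (List Carrier) λ xs → ∀ z → z ∈ xs

  IsModular : Set
  IsModular = ∀ x y z → x ≤ z → x ∨ (y ∧ z) ≡ (x ∨ y) ∧ z

  IsComplemented : Set
  IsComplemented = Σ Carrier λ ⊥ → Σ Carrier λ ⊤ →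
    (∀ z → ⊥ ≤ z) × (∀ z → z ≤ ⊤) ×
    (∀ a → ∃[ b ] ((a ∧ b ≡ ⊥) × (a ∨ b ≡ ⊤)))

  IsFilter : (Carrier → Set) → Set
  IsFilter F = (∃[ a ] F a) × (∀ a b → F a → a ≤ b → F b)
             × (∀ a b → F a → F b → F (a ∧ b))

  IsIdeal : (Carrier → Set) → Set
  IsIdeal I = (∃[ a ] I a) × (∀ a b → I b → a ≤ b → I a)
            × (∀ a b → I a → I b → I (a ∨ b))

  IsTolerance : (Carrier → Carrier → Set) → Set
  IsTolerance γ = (∀ a → γ a a) × (∀ a b → γ a b → γ b a)
    × (∀ a b c d → γ a b → γ c d → γ (a ∨ c) (b ∨ d))
    × (∀ a b c d → γ a b → γ c d → γ (a ∧ c) (b ∧ d))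

IsIsoOnto : (K L : LatticeOn) → (∣ K ∣ → Set) → (∣ L ∣ → Set)
          → (∣ K ∣ → ∣ L ∣) → Set
IsIsoOnto K L F I φ =
    (∀ a → F a → I (φ a))
  × (∀ b → I b → ∃[ a ] (F a × (φ a ≡ b)))
  × (∀ a a' → F a → F a' → φ a ≡ φ a' → a ≡ a')
  × (∀ a a' → F a → F a' → φ (a K.∨ a') ≡ φ a L.∨ φ a')
  × (∀ a a' → F a → F a' → φ (a K.∧ a') ≡ φ a L.∧ φ a')
  where module K = LatticeOn K
        module L = LatticeOn L

-- F x y, I x y, φ x y are given for all x y, but only constrained /
-- meaningful when x ≤_γ y (φ_x^y is encoded as a total map whose
-- relevant part is its restriction to F x y).
record ModularConnectedSystem : Set₁ where
  field
    S  : LatticeOn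
  open LatticeOn S
  field
    γ  : ∣ S ∣ → ∣ S ∣ → Set
    L  : ∣ S ∣ → LatticeOn
    F  : (x y : ∣ S ∣) → ∣ L x ∣ → Set
    I  : (x y : ∣ S ∣) → ∣ L y ∣ → Set
    φ  : (x y : ∣ S ∣) → ∣ L x ∣ → ∣ L y ∣

  _≤γ_ : ∣ S ∣ → ∣ S ∣ → Set
  x ≤γ y = (x ≤ y) × γ x y

  field
    tolerance : IsTolerance S γ
    MC1 : IsLFFC S
    MC2 : ∀ x → IsFinite (L x) × IsModular (L x) × IsComplemented (L x)
    MC3 : ∀ x y → x ≤γ y →
            IsFilter (L x) (F x y) × IsIdeal (L y) (I x y)
            × IsIsoOnto (L x) (L y) (F x y) (I x y) (φ x y)
    MC4 : ∀ x → (∀ a → F x x a) × (∀ a → I x x a) × (∀ a → φ x x a ≡ a)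
    MC5 : ∀ x y z → x ≤γ y → y ≤γ z →
            (∃[ b ] (I x y b × F y z b)) → γ x z
    MC6 : ∀ x z y → x ≤ z → z ≤ y → γ x y →
            (∀ a → F x y a ⇔ (F x z a × I x z (φ x z a) × F z y (φ x z a)))
          × (∀ b → I x y b ⇔ (∃[ c ] (I x z c × F z y c × (φ z y c ≡ b))))
          × (∀ a → F x y a → φ x y a ≡ φ z y (φ x z a))
    MC7 : ∀ x y → γ x y →
            (∀ b → I x (x ∨ y) b → I y (x ∨ y) b → I (x ∧ y) (x ∨ y) b)
          × (∀ a → F (x ∧ y) x a → F (x ∧ y) y a → F (x ∧ y) (x ∨ y) a)
    MC8-1 : ∀ x y → _⋖_ S x y → γ x y
    MC8-2 : ∀ x y → _⋖_ S x y → ¬ (∀ a → F x y a) × ¬ (∀ b → I x y b)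

  _∼_ : (Σ (∣ S ∣) λ x → ∣ L x ∣) → (Σ (∣ S ∣) λ x → ∣ L x ∣) → Set
  (x , a) ∼ (y , b) = γ x y × F x (x ∨ y) a × F y (x ∨ y) b
                    × (φ x (x ∨ y) a ≡ φ y (x ∨ y) b)

  -- Λ_x ∩ Λ_y ≠ ∅ : some class π_x(a) equals some class π_y(b),
  -- i.e. (x , a) ∼ (y , b)
  Λ∩Λ≠∅ : ∣ S ∣ → ∣ S ∣ → Set
  Λ∩Λ≠∅ x y = ∃[ a ] ∃[ b ] ((x , a) ∼ (y , b))

{-# OPTIONS --safe #-}
-- If x γ y then, γ being a tolerance, x ≤_γ x ∨ y and y ≤_γ x ∨ y.  The
-- ideals I_x^{x∨y} and I_y^{x∨y} then both contain the least element 0 of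
-- L_{x∨y}, so its preimages a ∈ F_x^{x∨y} and b ∈ F_y^{x∨y} satisfy
-- (x , a) ∼ (y , b).  The converse is part of the definition of ∼.
module Submission where

open import Defs
open import Function.Bundles using (_⇔_; mk⇔)
open import Data.Product using (∃-syntax; _×_; _,_)
open import Relation.Binary.PropositionalEquality using (_≡_; sym; trans; subst)
open import Relation.Binary.Lattice.Bundles using (Lattice)
open import Relation.Binary.Lattice.Structures using (IsLattice)
import Relation.Binary.Lattice.Properties.JoinSemilattice as JoinSemilatticeProperties

module _ (K : LatticeOn) where
  open LatticeOn K

  private
    lattice : Lattice _ _ _
    lattice = record { isLattice = isLattice }

  open JoinSemilatticeProperties (Lattice.joinSemilattice lattice)
    using (∨-idempotent)

  tolerance-∨ˡ : ∀ {γ} → IsTolerance K γ → ∀ {x y} → γ x y → γ x (x ∨ y)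
  tolerance-∨ˡ {γ} (reflexive , _ , ∨-compatible , _) {x} {y} xγy =
    subst (λ t → γ t (x ∨ y)) (∨-idempotent x) (∨-compatible x x x y (reflexive x) xγy)

  tolerance-∨ʳ : ∀ {γ} → IsTolerance K γ → ∀ {x y} → γ x y → γ y (x ∨ y)
  tolerance-∨ʳ {γ} (reflexive , symmetric , ∨-compatible , _) {x} {y} xγy =
    symmetric (x ∨ y) y
      (subst (γ (x ∨ y)) (∨-idempotent y) (∨-compatible x y y y xγy (reflexive y)))

  ideal-contains-bottom : ∀ {I} → IsIdeal K I → ∀ {0ₖ} → (∀ z → 0ₖ ≤ z) → I 0ₖ
  ideal-contains-bottom ((c , Ic) , downward , _) 0ₖ-≤ = downward _ c Ic (0ₖ-≤ c)

module _ (𝓜 : ModularConnectedSystem) where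
  open ModularConnectedSystem 𝓜
  open LatticeOn S

  bottom : ∀ z → ∣ L z ∣
  bottom z = let _ , _ , 0ₗ , _ = MC2 z in 0ₗ

  bottom-≤ : ∀ z a → LatticeOn._≤_ (L z) (bottom z) a
  bottom-≤ z = let _ , _ , _ , _ , bottom-≤ , _ = MC2 z in bottom-≤

  ≤γ-preimage-bottom : ∀ {u z} → u ≤γ z → ∃[ a ] (F u z a × (φ u z a ≡ bottom z))
  ≤γ-preimage-bottom {u} {z} u≤γz =
    let _ , ideal , _ , onto , _ = MC3 u z u≤γz
    in  onto (bottom z) (ideal-contains-bottom (L z) ideal (bottom-≤ z))

  ≤γ-∨ˡ : ∀ {x y} → γ x y → x ≤γ (x ∨ y)
  ≤γ-∨ˡ {x} {y} xγy = IsLattice.x≤x∨y isLattice x y , tolerance-∨ˡ S tolerance xγy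

  ≤γ-∨ʳ : ∀ {x y} → γ x y → y ≤γ (x ∨ y)
  ≤γ-∨ʳ {x} {y} xγy = IsLattice.y≤x∨y isLattice x y , tolerance-∨ʳ S tolerance xγy

lemma4p42 : (𝓜 : ModularConnectedSystem) → let open ModularConnectedSystem 𝓜 in
    ∀ x y → Λ∩Λ≠∅ x y ⇔ γ x y
lemma4p42 𝓜 x y = mk⇔ (λ (_ , _ , xγy , _) → xγy) meet-over-bottom
  where
  open ModularConnectedSystem 𝓜

  meet-over-bottom : γ x y → Λ∩Λ≠∅ x y
  meet-over-bottom xγy =
    let a , Fa , a↦0 = ≤γ-preimage-bottom 𝓜 (≤γ-∨ˡ 𝓜 xγy)
        b , Fb , b↦0 = ≤γ-preimage-bottom 𝓜 (≤γ-∨ʳ 𝓜 xγy)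
    in  a , b , xγy , Fa , Fb , trans a↦0 (sym b↦0)
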